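{- Let $n>2$ be an integer and let $\sigma\in C_n$. Then $$S_\sigma:=\sum_{x\in\mathbb{F}_2^n}(-1)^{x\cdot\sigma x}=\begin{cases}2^{\frac n2+\frac{n}{\mathrm{ord}(\sigma)}} & \text{if } \mathrm{ord}(\sigma)\text{ is even},\\ 0 & \text{if }\mathrm{ord}(\sigma)\text{ is odd}.\end{cases}$$
   Context: For $x,y\in\mathbb{F}_2^n$, $x\cdot y=\sum_{i=1}^n x_iy_i\in\mathbb{F}_2$, and $(-1)^{a}$ for $a\in\mathbb{F}_2$ means $1$ if $a=0$ and $-1$ if $a=1$. $\rho_n:\mathbb{F}_2^n\to\mathbb{F}_2^n$ is the cyclic shift $\rho_n(x_1,x_2,\dots,x_n)=(x_2,\dots,x_n,x_1)$, and $C_n=\langle\rho_n\rangle$ is the cyclic group it generates (acting on $\mathbb{F}_2^n$); $\mathrm{ord}(\sigma)$ is the order of $\sigma$ in this group. -}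

module Defs where

open import Data.Bool using (Bool; true; false; _∧_; _xor_)
open import Data.Nat using (ℕ; zero; suc; _≤_; _<_)
open import Data.Vec using (Vec; []; _∷_; _∷ʳ_; zipWith; foldr)
open import Data.List using (List; []; _∷_; _++_; map)
open import Data.Integer using (ℤ; +_; -_; _+_)
open import Data.Product using (_×_)
open import Relation.Binary.PropositionalEquality using (_≡_)
open import Relation.Nullary using (¬_)

-- Elements of F_2^n are Vec Bool n (true = 1, false = 0).

dot : ∀ {n} → Vec Bool n → Vec Bool n → Bool
dot x y = foldr _ _xor_ false (zipWith _∧_ x y)

sign : Bool → ℤ
sign false = + 1
sign true  = - (+ 1)

ρ : ∀ {n} → Vec Bool n → Vec Bool n
ρ []       = []
ρ (x ∷ xs) = xs ∷ʳ x

iter : ∀ {A : Set} → ℕ → (A → A) → A → A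
iter zero    f a = a
iter (suc k) f a = f (iter k f a)

allVecs : (n : ℕ) → List (Vec Bool n)
allVecs zero    = [] ∷ []
allVecs (suc n) = map (false ∷_) (allVecs n) ++ map (true ∷_) (allVecs n)

sumℤ : List ℤ → ℤ
sumℤ []       = + 0
sumℤ (z ∷ zs) = z + sumℤ zs

S : ∀ {n} → (Vec Bool n → Vec Bool n) → ℤ
S {n} σ = sumℤ (map (λ x → sign (dot x (σ x))) (allVecs n))

IsId : ∀ {n} → (Vec Bool n → Vec Bool n) → Set
IsId {n} σ = ∀ (x : Vec Bool n) → σ x ≡ x

IsOrder : ∀ {n} → (Vec Bool n → Vec Bool n) → ℕ → Set
IsOrder σ m = (1 ≤ m) × IsId (iter m σ) × (∀ j → 1 ≤ j → j < m → ¬ IsId (iter j σ))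

-- Over F₂, x · ρᵏx = Σᵢ xᵢ x_{i+k} with indices mod n. If m = ord(ρᵏ), the map i ↦ i + k splits
-- ℤ/n into d = n/m orbits of length m, so this quadratic form is a sum of d copies of the cycle
-- form Σ_{j<m} y_j y_{j+1 mod m} in disjoint sets of variables, and S is the d-th power of the
-- Gauss sum c_m of a single cycle. Summing out two adjacent vertices u, v of a cycle,
-- Σ_{u,v} (-1)^{xu + uv + vy} = 2 (-1)^{xy}, shortens it by two, so c_{m+2} = 2 c_m; with c₁ = 0
-- and c₂ = 4 this gives c_m = 2^{m/2+1} for even m and c_m = 0 for odd m.

module Submission where

open import Defs
open import Data.Bool using (Bool; true; false; _∧_; _xor_)
open import Data.Bool.Properties using (xor-assoc; xor-identityʳ; xor-∧-commutativeRing)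
open import Data.Nat
  using (ℕ; zero; suc; _<_; _≤_; _^_; _/_; _+_; _*_; _%_; NonZero; >-nonZero; ≢-nonZero⁻¹; z≤n; s≤s)
import Data.Nat.Properties as ℕ
open import Data.Vec using (Vec; []; _∷_; _∷ʳ_; replicate)
open import Data.List using (List; []; _∷_; _++_; map; applyUpTo; upTo; foldr; length)
open import Data.List.Membership.Propositional using (_∈_)
open import Data.List.Membership.Propositional.Properties
  using (∈-∃++; ∈-++⁻; ∈-applyUpTo⁻; ∈-upTo⁺)
open import Data.List.Relation.Unary.Any using (here; there)
import Data.List.Relation.Unary.All as All
open import Data.List.Relation.Unary.AllPairs using ([]; _∷_)
open import Data.List.Relation.Unary.Unique.Propositional using (Unique)
import Data.List.Relation.Unary.Unique.Propositional.Properties as Unique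
import Data.List.Properties as List
import Data.List.Relation.Binary.Permutation.Propositional as ↭
open ↭ using (_↭_; ↭-sym; ↭-trans; ↭-reflexive; ↭⇒↭ₛ)
import Data.List.Relation.Binary.Permutation.Propositional.Properties as Perm
import Data.List.Relation.Binary.Permutation.Setoid.Properties as PermSetoid
open import Data.Integer using (ℤ; +_) renaming (_+_ to _+ℤ_; _*_ to _*ℤ_; _^_ to _^ℤ_)
import Data.Integer.Properties as ℤ
open import Data.Integer.Tactic.RingSolver using (solve-∀)
open import Data.Nat.Tactic.RingSolver using () renaming (solve-∀ to ℕ-solve-∀)
open import Algebra.Bundles using (CommutativeRing)
open import Algebra.Properties.CommutativeSemigroup ℤ.+-commutativeSemigroup
  using () renaming (interchange to +-interchange)
open import Algebra.Properties.CommutativeSemigroup ℤ.*-commutativeSemigroup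
  using ()
  renaming (xy∙z≈y∙xz to *-xy∙z≈y∙xz; x∙yz≈yx∙z to *-x∙yz≈yx∙z; x∙yz≈y∙xz to *-x∙yz≈y∙xz)
open import Relation.Binary.PropositionalEquality
open import Relation.Nullary using (¬_; yes; no)
open import Relation.Binary.Definitions using (tri<; tri≈; tri>)
open import Data.Empty using (⊥-elim)
open import Data.Nat.DivMod
  using ( m≡m%n+[m/n]*n; m%n<n; m<n⇒m%n≡m; n%n≡0; m%n%n≡m%n; %-distribˡ-+; %-remove-+ʳ
        ; m∣n⇒o%n%m≡o%m; m≥n⇒m/n>0; m/n*n≡m; m*n/n≡m)
open import Data.Nat.Divisibility
  using (_∣_; divides; m%n≡0⇒n∣m; *-cancelʳ-∣; ∣n⇒∣m*n; m∣m*n; ∣⇒≤)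
open import Data.Product using (_×_; _,_; proj₁; proj₂; ∃)
open import Data.Sum using (inj₁; inj₂)
open import Function using (_∘_)

infixl 9 _!_
infixl 8 _[_]≔_

-- Coordinates are addressed by natural numbers; out-of-range reads give false.
_!_ : ∀ {n} → Vec Bool n → ℕ → Bool
[]       ! i     = false
(x ∷ xs) ! zero  = x
(x ∷ xs) ! suc i = xs ! i

_[_]≔_ : ∀ {n} → Vec Bool n → ℕ → Bool → Vec Bool n
[]       [ i     ]≔ b = []
(x ∷ xs) [ zero  ]≔ b = b ∷ xs
(x ∷ xs) [ suc i ]≔ b = x ∷ (xs [ i ]≔ b)

!-≔ : ∀ {n} (a : Vec Bool n) {i} b → i < n → (a [ i ]≔ b) ! i ≡ b
!-≔ (x ∷ a) {zero}  b _         = refl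
!-≔ (x ∷ a) {suc i} b (s≤s i<n) = !-≔ a b i<n

!-≔-≢ : ∀ {n} (a : Vec Bool n) {i j} b → i ≢ j → (a [ i ]≔ b) ! j ≡ a ! j
!-≔-≢ []      {i}     {j}     b i≢j = refl
!-≔-≢ (x ∷ a) {zero}  {zero}  b i≢j = ⊥-elim (i≢j refl)
!-≔-≢ (x ∷ a) {zero}  {suc j} b i≢j = refl
!-≔-≢ (x ∷ a) {suc i} {zero}  b i≢j = refl
!-≔-≢ (x ∷ a) {suc i} {suc j} b i≢j = !-≔-≢ a b (i≢j ∘ cong suc)

≔-comm : ∀ {n} (a : Vec Bool n) {i j} b c → i ≢ j →
         a [ i ]≔ b [ j ]≔ c ≡ a [ j ]≔ c [ i ]≔ b
≔-comm []      {i}     {j}     b c i≢j = refl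
≔-comm (x ∷ a) {zero}  {zero}  b c i≢j = ⊥-elim (i≢j refl)
≔-comm (x ∷ a) {zero}  {suc j} b c i≢j = refl
≔-comm (x ∷ a) {suc i} {zero}  b c i≢j = refl
≔-comm (x ∷ a) {suc i} {suc j} b c i≢j = cong (x ∷_) (≔-comm a b c (i≢j ∘ cong suc))

!-ext : ∀ {n} (x y : Vec Bool n) → (∀ i → i < n → x ! i ≡ y ! i) → x ≡ y
!-ext []       []       eq = refl
!-ext (x ∷ xs) (y ∷ ys) eq =
  cong₂ _∷_ (eq 0 (s≤s z≤n)) (!-ext xs ys (λ i i<n → eq (suc i) (s≤s i<n)))

!-replicate-false : ∀ n i → replicate n false ! i ≡ false
!-replicate-false zero    i       = refl
!-replicate-false (suc n) zero    = refl
!-replicate-false (suc n) (suc i) = !-replicate-false n i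

-- Sums over coordinates

Fun : ℕ → Set
Fun n = Vec Bool n → ℤ

sumAt : ∀ {n} → ℕ → Fun n → Fun n
sumAt i F a = F (a [ i ]≔ false) +ℤ F (a [ i ]≔ true)

-- For a list is without repetitions, sumOver is F a sums F over all values of the coordinates
-- in is, the other coordinates being read from a.
sumOver : ∀ {n} → List ℕ → Fun n → Fun n
sumOver []       F = F
sumOver (i ∷ is) F = sumAt i (sumOver is F)

sumOver-cong : ∀ {n} is {F G : Fun n} → (∀ a → F a ≡ G a) →
               ∀ a → sumOver is F a ≡ sumOver is G a
sumOver-cong []       F≗G a = F≗G a
sumOver-cong (i ∷ is) F≗G a = cong₂ _+ℤ_ (sumOver-cong is F≗G _) (sumOver-cong is F≗G _)

sumOver-++ : ∀ {n} is js (F : Fun n) a → sumOver (is ++ js) F a ≡ sumOver is (sumOver js F) a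
sumOver-++ []       js F a = refl
sumOver-++ (i ∷ is) js F a = cong₂ _+ℤ_ (sumOver-++ is js F _) (sumOver-++ is js F _)

sumAt-comm : ∀ {n} i j (F : Fun n) a → sumAt i (sumAt j F) a ≡ sumAt j (sumAt i F) a
sumAt-comm {n} i j F a with i ℕ.≟ j
... | yes refl = refl
... | no i≢j   = begin
  (F (a′ f f) +ℤ F (a′ f t)) +ℤ (F (a′ t f) +ℤ F (a′ t t))
    ≡⟨ cong₂ _+ℤ_ (cong₂ _+ℤ_ (swapped f f) (swapped f t))
                  (cong₂ _+ℤ_ (swapped t f) (swapped t t)) ⟩
  (F (a″ f f) +ℤ F (a″ f t)) +ℤ (F (a″ t f) +ℤ F (a″ t t))
    ≡⟨ +-interchange (F (a″ f f)) (F (a″ f t)) (F (a″ t f)) (F (a″ t t)) ⟩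
  (F (a″ f f) +ℤ F (a″ t f)) +ℤ (F (a″ f t) +ℤ F (a″ t t)) ∎
  where
  open ≡-Reasoning
  f t : Bool
  f = false
  t = true
  a′ a″ : Bool → Bool → Vec Bool n
  a′ b c = a [ i ]≔ b [ j ]≔ c
  a″ b c = a [ j ]≔ c [ i ]≔ b
  swapped : ∀ b c → F (a′ b c) ≡ F (a″ b c)
  swapped b c = cong F (≔-comm a b c i≢j)

sumOver-↭ : ∀ {n} {is js} → is ↭ js → ∀ (F : Fun n) a → sumOver is F a ≡ sumOver js F a
sumOver-↭ ↭.refl         F a = refl
sumOver-↭ (↭.prep i p)   F a = cong₂ _+ℤ_ (sumOver-↭ p F _) (sumOver-↭ p F _)
sumOver-↭ (↭.swap {_} {js} i j p) F a =
  trans (cong₂ _+ℤ_ (cong₂ _+ℤ_ (sumOver-↭ p F _) (sumOver-↭ p F _))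
                    (cong₂ _+ℤ_ (sumOver-↭ p F _) (sumOver-↭ p F _)))
        (sumAt-comm i j (sumOver js F) a)
sumOver-↭ (↭.trans p q)  F a = trans (sumOver-↭ p F a) (sumOver-↭ q F a)

sumOver-map-suc : ∀ {n} is (F : Fun (suc n)) b (a : Vec Bool n) →
                  sumOver (map suc is) F (b ∷ a) ≡ sumOver is (F ∘ (b ∷_)) a
sumOver-map-suc []       F b a = refl
sumOver-map-suc (i ∷ is) F b a = cong₂ _+ℤ_ (sumOver-map-suc is F b _) (sumOver-map-suc is F b _)

sumℤ-++ : ∀ xs ys → sumℤ (xs ++ ys) ≡ sumℤ xs +ℤ sumℤ ys
sumℤ-++ []       ys = sym (ℤ.+-identityˡ _)
sumℤ-++ (x ∷ xs) ys = trans (cong (x +ℤ_) (sumℤ-++ xs ys)) (sym (ℤ.+-assoc x _ _))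

sumℤ-allVecs : ∀ n (F : Fun n) a → sumℤ (map F (allVecs n)) ≡ sumOver (upTo n) F a
sumℤ-allVecs zero    F [] = ℤ.+-identityʳ _
sumℤ-allVecs (suc n) F (b ∷ a) = begin
  sumℤ (map F (map (false ∷_) vs ++ map (true ∷_) vs))
    ≡⟨ cong sumℤ (List.map-++ F (map (false ∷_) vs) _) ⟩
  sumℤ (map F (map (false ∷_) vs) ++ map F (map (true ∷_) vs))
    ≡⟨ sumℤ-++ (map F (map (false ∷_) vs)) _ ⟩
  sumℤ (map F (map (false ∷_) vs)) +ℤ sumℤ (map F (map (true ∷_) vs))
    ≡⟨ cong₂ _+ℤ_ (half false) (half true) ⟩
  sumOver (upTo n) (F ∘ (false ∷_)) a +ℤ sumOver (upTo n) (F ∘ (true ∷_)) a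
    ≡⟨ sym (cong₂ _+ℤ_ (sumOver-map-suc (upTo n) F false a) (sumOver-map-suc (upTo n) F true a)) ⟩
  sumOver (map suc (upTo n)) F (false ∷ a) +ℤ sumOver (map suc (upTo n)) F (true ∷ a)
    ≡⟨ cong (λ is → sumOver is F (false ∷ a) +ℤ sumOver is F (true ∷ a))
            (List.map-upTo suc n) ⟩
  sumOver (upTo (suc n)) F (b ∷ a) ∎
  where
  open ≡-Reasoning
  vs : List (Vec Bool n)
  vs = allVecs n
  half : ∀ c → sumℤ (map F (map (c ∷_) vs)) ≡ sumOver (upTo n) (F ∘ (c ∷_)) a
  half c = trans (cong sumℤ (sym (List.map-∘ vs))) (sumℤ-allVecs n (F ∘ (c ∷_)) a)

xorSum : List Bool → Bool
xorSum = foldr _xor_ false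

xorSum-++ : ∀ xs ys → xorSum (xs ++ ys) ≡ xorSum xs xor xorSum ys
xorSum-++ []       ys = refl
xorSum-++ (x ∷ xs) ys = trans (cong (x xor_) (xorSum-++ xs ys)) (sym (xor-assoc x _ _))

xorSum-↭ : ∀ {xs ys} → xs ↭ ys → xorSum xs ≡ xorSum ys
xorSum-↭ = PermSetoid.foldr-commMonoid (setoid Bool) +-isCommutativeMonoid ∘ ↭⇒↭ₛ
  where open CommutativeRing xor-∧-commutativeRing using (+-isCommutativeMonoid)

unique-⊆⇒↭ : ∀ {xs ys : List ℕ} → Unique xs → (∀ {z} → z ∈ xs → z ∈ ys) →
             length xs ≡ length ys → xs ↭ ys
unique-⊆⇒↭ {[]}     {[]}    _ _ _ = ↭.refl
unique-⊆⇒↭ {x ∷ xs} {ys} (x≢xs ∷ xs!) xs⊆ys len with ∈-∃++ (xs⊆ys (here refl))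
... | as , bs , refl =
  ↭-trans (↭.prep x (unique-⊆⇒↭ xs! xs⊆as++bs len′)) (↭-sym (Perm.shift x as bs))
  where
  xs⊆as++bs : ∀ {z} → z ∈ xs → z ∈ as ++ bs
  xs⊆as++bs z∈xs with Perm.∈-resp-↭ (Perm.shift x as bs) (xs⊆ys (there z∈xs))
  ... | here z≡x       = ⊥-elim (All.lookup x≢xs z∈xs (sym z≡x))
  ... | there z∈as++bs = z∈as++bs
  len′ : length xs ≡ length (as ++ bs)
  len′ = ℕ.suc-injective (trans len (Perm.↭-length (Perm.shift x as bs)))

xorSum-applyUpTo-cong : ∀ r {f g : ℕ → Bool} → (∀ j → j < r → f j ≡ g j) →
                        xorSum (applyUpTo f r) ≡ xorSum (applyUpTo g r)
xorSum-applyUpTo-cong zero    f≗g = refl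
xorSum-applyUpTo-cong (suc r) f≗g =
  cong₂ _xor_ (f≗g 0 (s≤s z≤n)) (xorSum-applyUpTo-cong r (λ j j<r → f≗g (suc j) (s≤s j<r)))

xorSum-applyUpTo-suc : ∀ r (f : ℕ → Bool) →
                       xorSum (applyUpTo f (suc r)) ≡ xorSum (applyUpTo f r) xor f r
xorSum-applyUpTo-suc r f = begin
  xorSum (applyUpTo f (suc r))
    ≡⟨ cong xorSum (sym (List.applyUpTo-∷ʳ f r)) ⟩
  xorSum (applyUpTo f r ++ f r ∷ [])
    ≡⟨ xorSum-++ (applyUpTo f r) _ ⟩
  xorSum (applyUpTo f r) xor (f r xor false)
    ≡⟨ cong (xorSum (applyUpTo f r) xor_) (xor-identityʳ (f r)) ⟩
  xorSum (applyUpTo f r) xor f r ∎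
  where open ≡-Reasoning

dot≡xorSum : ∀ {n} (x y : Vec Bool n) → dot x y ≡ xorSum (applyUpTo (λ i → x ! i ∧ y ! i) n)
dot≡xorSum []       []       = refl
dot≡xorSum (x ∷ xs) (y ∷ ys) = cong ((x ∧ y) xor_) (dot≡xorSum xs ys)

sign-xor : ∀ a b → sign (a xor b) ≡ sign a *ℤ sign b
sign-xor false false = refl
sign-xor false true  = refl
sign-xor true  false = refl
sign-xor true  true  = refl

-- Rotations and their orders

[m%o+n]%o≡[m+n]%o : ∀ m n o .{{_ : NonZero o}} → (m % o + n) % o ≡ (m + n) % o
[m%o+n]%o≡[m+n]%o m n o = begin
  (m % o + n) % o            ≡⟨ %-distribˡ-+ (m % o) n o ⟩
  (m % o % o + n % o) % o    ≡⟨ cong (λ r → (r + n % o) % o) (m%n%n≡m%n m o) ⟩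
  (m % o + n % o) % o        ≡⟨ sym (%-distribˡ-+ m n o) ⟩
  (m + n) % o                ∎
  where open ≡-Reasoning

%-≡-+⇒∣ : ∀ a b {o} .{{_ : NonZero o}} → a % o ≡ (a + b) % o → o ∣ b
%-≡-+⇒∣ a b {o} eq = divides q (ℕ.+-cancelˡ-≡ (a % o) _ _ (begin
  a % o + b                   ≡⟨ m≡m%n+[m/n]*n (a % o + b) o ⟩
  (a % o + b) % o + q * o     ≡⟨ cong (_+ q * o) ([m%o+n]%o≡[m+n]%o a b o) ⟩
  (a + b) % o + q * o         ≡⟨ cong (_+ q * o) (sym eq) ⟩
  a % o + q * o               ∎))
  where
  open ≡-Reasoning
  q : ℕ
  q = (a % o + b) / o

iter-+ : ∀ {A : Set} i j (f : A → A) x → iter (i + j) f x ≡ iter i f (iter j f x)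
iter-+ zero    j f x = refl
iter-+ (suc i) j f x = cong f (iter-+ i j f x)

iter-* : ∀ {A : Set} i j (f : A → A) x → iter i (iter j f) x ≡ iter (i * j) f x
iter-* zero    j f x = refl
iter-* (suc i) j f x = trans (cong (iter j f) (iter-* i j f x)) (sym (iter-+ j (i * j) f x))

iter-isId : ∀ {n} {σ : Vec Bool n → Vec Bool n} q → IsId σ → IsId (iter q σ)
iter-isId zero    σ-id x = refl
iter-isId (suc q) σ-id x = trans (σ-id _) (iter-isId q σ-id x)

order-∣ : ∀ {n} {σ : Vec Bool n → Vec Bool n} {m} .{{_ : NonZero m}} j →
          IsOrder σ m → IsId (iter j σ) → m ∣ j
order-∣ {σ = σ} {m} j (_ , σᵐ-id , minimal) σʲ-id =
  m%n≡0⇒n∣m j m (below-order-isId⇒0 (j % m) (m%n<n j m) σʳ-id)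
  where
  below-order-isId⇒0 : ∀ r → r < m → IsId (iter r σ) → r ≡ 0
  below-order-isId⇒0 zero    _   _    = refl
  below-order-isId⇒0 (suc r) r<m σʳ-id = ⊥-elim (minimal (suc r) (s≤s z≤n) r<m σʳ-id)
  σʳ-id : IsId (iter (j % m) σ)
  σʳ-id x = begin
    iter (j % m) σ x
      ≡⟨ cong (iter (j % m) σ) (sym (iter-isId (j / m) σᵐ-id x)) ⟩
    iter (j % m) σ (iter (j / m) (iter m σ) x)
      ≡⟨ cong (iter (j % m) σ) (iter-* (j / m) m σ x) ⟩
    iter (j % m) σ (iter (j / m * m) σ x)
      ≡⟨ sym (iter-+ (j % m) (j / m * m) σ x) ⟩
    iter (j % m + j / m * m) σ x
      ≡⟨ cong (λ i → iter i σ x) (sym (m≡m%n+[m/n]*n j m)) ⟩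
    iter j σ x
      ≡⟨ σʲ-id x ⟩
    x ∎
    where open ≡-Reasoning

!-∷ʳ : ∀ {n} (xs : Vec Bool n) y {i} → i < n → (xs ∷ʳ y) ! i ≡ xs ! i
!-∷ʳ (x ∷ xs) y {zero}  _         = refl
!-∷ʳ (x ∷ xs) y {suc i} (s≤s i<n) = !-∷ʳ xs y i<n

!-∷ʳ-last : ∀ {n} (xs : Vec Bool n) y → (xs ∷ʳ y) ! n ≡ y
!-∷ʳ-last []       y = refl
!-∷ʳ-last (x ∷ xs) y = !-∷ʳ-last xs y

!-ρ : ∀ {n} (x : Vec Bool (suc n)) {i} → i < suc n → ρ x ! i ≡ x ! (suc i % suc n)
!-ρ {n} (y ∷ ys) {i} i<1+n with ℕ.m≤n⇒m<n∨m≡n (ℕ.≤-pred i<1+n)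
... | inj₁ i<n  = trans (!-∷ʳ ys y i<n) (cong ((y ∷ ys) !_) (sym (m<n⇒m%n≡m (s≤s i<n))))
... | inj₂ refl = trans (!-∷ʳ-last ys y) (cong ((y ∷ ys) !_) (sym (n%n≡0 (suc n))))

!-iter-ρ : ∀ {n} .{{_ : NonZero n}} k (x : Vec Bool n) {i} → i < n →
           iter k ρ x ! i ≡ x ! ((i + k) % n)
!-iter-ρ {suc n} zero    x {i} i<n =
  cong (x !_) (sym (trans (cong (_% suc n) (ℕ.+-identityʳ i)) (m<n⇒m%n≡m i<n)))
!-iter-ρ {suc n} (suc k) x {i} i<n = begin
  ρ (iter k ρ x) ! i                      ≡⟨ !-ρ (iter k ρ x) i<n ⟩
  iter k ρ x ! (suc i % suc n)            ≡⟨ !-iter-ρ k x (m%n<n (suc i) (suc n)) ⟩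
  x ! ((suc i % suc n + k) % suc n)       ≡⟨ cong (x !_) ([m%o+n]%o≡[m+n]%o (suc i) k (suc n)) ⟩
  x ! ((suc i + k) % suc n)               ≡⟨ cong (λ j → x ! (j % suc n)) (sym (ℕ.+-suc i k)) ⟩
  x ! ((i + suc k) % suc n)               ∎
  where open ≡-Reasoning

∣⇒iter-ρ-isId : ∀ {n} .{{_ : NonZero n}} j → n ∣ j → IsId {n} (iter j ρ)
∣⇒iter-ρ-isId {n} j n∣j x = !-ext _ x λ i i<n →
  trans (!-iter-ρ j x i<n) (cong (x !_) (trans (%-remove-+ʳ i n∣j) (m<n⇒m%n≡m i<n)))

iter-ρ-isId⇒∣ : ∀ {n} .{{_ : NonZero n}} j → IsId {n} (iter j ρ) → n ∣ j
iter-ρ-isId⇒∣ {suc n} j ρʲ-id = m%n≡0⇒n∣m j (suc n) (unit-only-at-0 (j % suc n) unit-at-j%n)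
  where
  unit : Vec Bool (suc n)
  unit = true ∷ replicate n false
  unit-at-j%n : unit ! (j % suc n) ≡ true
  unit-at-j%n = trans (sym (!-iter-ρ j unit (s≤s z≤n))) (cong (_! 0) (ρʲ-id unit))
  unit-only-at-0 : ∀ i → unit ! i ≡ true → i ≡ 0
  unit-only-at-0 zero    _ = refl
  unit-only-at-0 (suc i) eq with trans (sym (!-replicate-false n i)) eq
  ... | ()

order-of-rotation : ∀ {n k m} .{{_ : NonZero n}} .{{_ : NonZero m}} → IsOrder {n} (iter k ρ) m →
                    n ∣ m * k × (∀ j → 0 < j → j < m → ¬ n ∣ j * k) × m ∣ n
order-of-rotation {n} {k} {m} σ-order@(_ , σᵐ-id , minimal) =
  iter-ρ-isId⇒∣ (m * k) (λ x → trans (sym (iter-* m k ρ x)) (σᵐ-id x)) ,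
  (λ j 0<j j<m n∣j*k →
     minimal j 0<j j<m (λ x → trans (iter-* j k ρ x) (∣⇒iter-ρ-isId (j * k) n∣j*k x))) ,
  order-∣ n σ-order (λ x → trans (iter-* n k ρ x) (∣⇒iter-ρ-isId (n * k) (m∣m*n k) x))

-- Cycle forms and their Gauss sums

record Embedding (r n : ℕ) (p : ℕ → ℕ) : Set where
  field
    bounded   : ∀ {j} → j < r → p j < n
    injective : ∀ {j j′} → j < r → j′ < r → p j ≡ p j′ → j ≡ j′

  distinct : ∀ {j j′} → j < r → j′ < r → j ≢ j′ → p j ≢ p j′
  distinct j<r j′<r j≢j′ = j≢j′ ∘ injective j<r j′<r

embedding-suc : ∀ {r n p} → Embedding (suc r) n p → Embedding r n (p ∘ suc)
embedding-suc emb = record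
  { bounded   = λ j<r → bounded (s≤s j<r)
  ; injective = λ j<r j′<r eq → ℕ.suc-injective (injective (s≤s j<r) (s≤s j′<r) eq)
  }
  where open Embedding emb

embedding-≤ : ∀ {r r′ n p} → r ≤ r′ → Embedding r′ n p → Embedding r n p
embedding-≤ r≤r′ emb = record
  { bounded   = λ j<r → bounded (ℕ.<-≤-trans j<r r≤r′)
  ; injective = λ j<r j′<r → injective (ℕ.<-≤-trans j<r r≤r′) (ℕ.<-≤-trans j′<r r≤r′)
  }
  where open Embedding emb

Independent : ∀ {n} → ℕ → Fun n → Set
Independent i G = ∀ a b → G (a [ i ]≔ b) ≡ G a

pathForm : ∀ {n} → (ℕ → ℕ) → ℕ → Vec Bool n → Bool
pathForm p r a = xorSum (applyUpTo (λ j → a ! p j ∧ a ! p (suc j)) r)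

cycleForm : ∀ {n} → (ℕ → ℕ) → ℕ → Vec Bool n → Bool
cycleForm p zero    a = false
cycleForm p (suc r) a = pathForm p r a xor (a ! p r ∧ a ! p 0)

pathForm-cong : ∀ {n} p r (a a′ : Vec Bool n) → (∀ j → j ≤ r → a ! p j ≡ a′ ! p j) →
                pathForm p r a ≡ pathForm p r a′
pathForm-cong p r a a′ a≗a′ =
  xorSum-applyUpTo-cong r (λ j j<r → cong₂ _∧_ (a≗a′ j (ℕ.<⇒≤ j<r)) (a≗a′ (suc j) j<r))

cycleForm-cong : ∀ {n} p r (a a′ : Vec Bool n) → (∀ j → j < r → a ! p j ≡ a′ ! p j) →
                 cycleForm p r a ≡ cycleForm p r a′
cycleForm-cong p zero    a a′ a≗a′ = refl
cycleForm-cong p (suc r) a a′ a≗a′ =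
  cong₂ _xor_ (pathForm-cong p r a a′ (λ j j≤r → a≗a′ j (s≤s j≤r)))
              (cong₂ _∧_ (a≗a′ r ℕ.≤-refl) (a≗a′ 0 (s≤s z≤n)))

cycleForm-unfold : ∀ {n} p r (a : Vec Bool n) →
  cycleForm p (3 + r) a ≡
    ((a ! p 0 ∧ a ! p 1) xor (pathForm (p ∘ suc) r a xor (a ! p (1 + r) ∧ a ! p (2 + r))))
    xor (a ! p (2 + r) ∧ a ! p 0)
cycleForm-unfold p r a =
  cong (λ s → ((a ! p 0 ∧ a ! p 1) xor s) xor (a ! p (2 + r) ∧ a ! p 0))
       (xorSum-applyUpTo-suc r (λ j → a ! p (suc j) ∧ a ! p (2 + j)))

xorSum-closed-walk : ∀ {n} (a : Vec Bool n) (s p : ℕ → ℕ) r →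
                     (∀ j → j < r → s (p j) ≡ p (suc j)) → p r ≡ p 0 →
                     xorSum (applyUpTo (λ j → a ! p j ∧ a ! s (p j)) r) ≡ cycleForm p r a
xorSum-closed-walk a s p zero    step closed = refl
xorSum-closed-walk a s p (suc r) step closed = begin
  xorSum (applyUpTo (λ j → a ! p j ∧ a ! s (p j)) (suc r))
    ≡⟨ xorSum-applyUpTo-suc r (λ j → a ! p j ∧ a ! s (p j)) ⟩
  xorSum (applyUpTo (λ j → a ! p j ∧ a ! s (p j)) r) xor (a ! p r ∧ a ! s (p r))
    ≡⟨ cong₂ _xor_ (xorSum-applyUpTo-cong r λ j j<r →
                     cong (λ i → a ! p j ∧ a ! i) (step j (ℕ.m≤n⇒m≤1+n j<r)))
                   (cong (λ i → a ! p r ∧ a ! i) (trans (step r ℕ.≤-refl) closed)) ⟩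
  cycleForm p (suc r) a ∎
  where open ≡-Reasoning

-- Gauss sums of the cycle forms; length 2 is degenerate since y₀y₁ + y₁y₀ = 0.
cycleSum : ℕ → ℤ
cycleSum 0 = + 1
cycleSum 1 = + 0
cycleSum 2 = + 4
cycleSum (suc (suc (suc r))) = + 2 *ℤ cycleSum (suc r)

signSum₂ : (Bool → Bool → Bool) → ℤ
signSum₂ K =
  (sign (K false false) +ℤ sign (K false true)) +ℤ (sign (K true false) +ℤ sign (K true true))

-- Summing out the two inner vertices u, v of a path x — u — v — y leaves twice the edge x — y.
signSum₂-bypass : ∀ x y A →
                  signSum₂ (λ u v → ((u ∧ x) xor (A xor (y ∧ v))) xor (v ∧ u)) ≡ + 2 *ℤ sign (A xor (y ∧ x))
signSum₂-bypass false false false = refl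
signSum₂-bypass false false true  = refl
signSum₂-bypass false true  false = refl
signSum₂-bypass false true  true  = refl
signSum₂-bypass true  false false = refl
signSum₂-bypass true  false true  = refl
signSum₂-bypass true  true  false = refl
signSum₂-bypass true  true  true  = refl

sumAt-factor : ∀ {n} i (H : Fun n) a (K : Bool → Bool) g →
               (∀ u → H (a [ i ]≔ u) ≡ sign (K u) *ℤ g) →
               sumAt i H a ≡ (sign (K false) +ℤ sign (K true)) *ℤ g
sumAt-factor i H a K g H≡ =
  trans (cong₂ _+ℤ_ (H≡ false) (H≡ true)) (sym (ℤ.*-distribʳ-+ g (sign (K false)) (sign (K true))))

sumOver-pair-factor : ∀ {n} i j (H : Fun n) a (K : Bool → Bool → Bool) g →
                      (∀ u v → H (a [ i ]≔ u [ j ]≔ v) ≡ sign (K u v) *ℤ g) →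
                      sumOver (i ∷ j ∷ []) H a ≡ signSum₂ K *ℤ g
sumOver-pair-factor i j H a K g H≡ =
  trans (cong₂ _+ℤ_ (cong₂ _+ℤ_ (H≡ false false) (H≡ false true))
                    (cong₂ _+ℤ_ (H≡ true false) (H≡ true true)))
        (distrib (sign (K false false)) (sign (K false true)) (sign (K true false)) (sign (K true true)) g)
  where
  distrib : ∀ s₁ s₂ s₃ s₄ g →
            (s₁ *ℤ g +ℤ s₂ *ℤ g) +ℤ (s₃ *ℤ g +ℤ s₄ *ℤ g) ≡ ((s₁ +ℤ s₂) +ℤ (s₃ +ℤ s₄)) *ℤ g
  distrib = solve-∀

sumOver-ends : ∀ {n} r p → Embedding (3 + r) n p → (G : Fun n) →
               Independent (p 0) G → Independent (p (2 + r)) G → ∀ b →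
               sumOver (p 0 ∷ p (2 + r) ∷ []) (λ e → sign (cycleForm p (3 + r) e) *ℤ G e) b
                 ≡ sign (cycleForm (p ∘ suc) (1 + r) b) *ℤ (+ 2 *ℤ G b)
sumOver-ends {n} r p emb G indep₀ indepₗ b = begin
  sumOver (p 0 ∷ p (2 + r) ∷ []) (λ e → sign (cycleForm p (3 + r) e) *ℤ G e) b
    ≡⟨ sumOver-pair-factor (p 0) (p (2 + r)) (λ e → sign (cycleForm p (3 + r) e) *ℤ G e) b K (G b)
                           summand ⟩
  signSum₂ K *ℤ G b
    ≡⟨ cong (_*ℤ G b) (signSum₂-bypass x y A) ⟩
  (+ 2 *ℤ sign (A xor (y ∧ x))) *ℤ G b
    ≡⟨ *-xy∙z≈y∙xz (+ 2) (sign (A xor (y ∧ x))) (G b) ⟩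
  sign (A xor (y ∧ x)) *ℤ (+ 2 *ℤ G b) ∎
  where
  open ≡-Reasoning
  open Embedding emb
  x y A : Bool
  x = b ! p 1
  y = b ! p (1 + r)
  A = pathForm (p ∘ suc) r b
  K : Bool → Bool → Bool
  K u v = ((u ∧ x) xor (A xor (y ∧ v))) xor (v ∧ u)
  e : Bool → Bool → Vec Bool n
  e u v = b [ p 0 ]≔ u [ p (2 + r) ]≔ v
  0<3+r : 0 < 3 + r
  0<3+r = s≤s z≤n
  2+r<3+r : 2 + r < 3 + r
  2+r<3+r = ℕ.≤-refl
  e-first : ∀ u v → e u v ! p 0 ≡ u
  e-first u v = trans (!-≔-≢ (b [ p 0 ]≔ u) v (distinct 2+r<3+r 0<3+r λ ()))
                      (!-≔ b u (bounded 0<3+r))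
  e-last : ∀ u v → e u v ! p (2 + r) ≡ v
  e-last u v = !-≔ (b [ p 0 ]≔ u) v (bounded 2+r<3+r)
  e-inner : ∀ u v j → j ≤ r → e u v ! p (suc j) ≡ b ! p (suc j)
  e-inner u v j j≤r =
    trans (!-≔-≢ (b [ p 0 ]≔ u) v
                 (distinct 2+r<3+r j+1<3+r (ℕ.<⇒≢ (s≤s (s≤s j≤r)) ∘ sym)))
          (!-≔-≢ b u (distinct 0<3+r j+1<3+r λ ()))
    where
    j+1<3+r : suc j < 3 + r
    j+1<3+r = s≤s (s≤s (ℕ.m≤n⇒m≤1+n j≤r))
  form : ∀ u v → cycleForm p (3 + r) (e u v) ≡ K u v
  form u v
    rewrite cycleForm-unfold p r (e u v) | e-first u v | e-last u v
          | e-inner u v 0 z≤n | e-inner u v r ℕ.≤-refl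
          | pathForm-cong (p ∘ suc) r (e u v) b (e-inner u v) = refl
  summand : ∀ u v → sign (cycleForm p (3 + r) (e u v)) *ℤ G (e u v) ≡ sign (K u v) *ℤ G b
  summand u v = cong₂ _*ℤ_ (cong sign (form u v)) (trans (indepₗ (b [ p 0 ]≔ u) v) (indep₀ b u))

cycle-sum : ∀ {n} r p → Embedding r n p → (G : Fun n) → (∀ {j} → j < r → Independent (p j) G) →
            ∀ a → sumOver (applyUpTo p r) (λ e → sign (cycleForm p r e) *ℤ G e) a
                    ≡ cycleSum r *ℤ G a
cycle-sum 0 p emb G indep a = refl
cycle-sum 1 p emb G indep a =
  sumAt-factor (p 0) (λ e → sign (cycleForm p 1 e) *ℤ G e) a (λ u → false xor (u ∧ u)) (G a) summand
  where
  open Embedding emb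
  summand : ∀ u → sign (cycleForm p 1 (a [ p 0 ]≔ u)) *ℤ G (a [ p 0 ]≔ u)
                    ≡ sign (false xor (u ∧ u)) *ℤ G a
  summand u = cong₂ _*ℤ_ (cong (λ y → sign (false xor (y ∧ y))) (!-≔ a u (bounded (s≤s z≤n))))
                         (indep (s≤s z≤n) a u)
cycle-sum 2 p emb G indep a =
  sumOver-pair-factor (p 0) (p 1) (λ e → sign (cycleForm p 2 e) *ℤ G e) a K (G a) summand
  where
  open Embedding emb
  K : Bool → Bool → Bool
  K u v = ((u ∧ v) xor false) xor (v ∧ u)
  0<2 : 0 < 2
  0<2 = s≤s z≤n
  1<2 : 1 < 2
  1<2 = s≤s (s≤s z≤n)
  summand : ∀ u v → sign (cycleForm p 2 (a [ p 0 ]≔ u [ p 1 ]≔ v)) *ℤ G (a [ p 0 ]≔ u [ p 1 ]≔ v)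
                      ≡ sign (K u v) *ℤ G a
  summand u v = cong₂ _*ℤ_ (cong sign (cong₂ (λ y z → ((y ∧ z) xor false) xor (z ∧ y)) first second))
                           (trans (indep 1<2 (a [ p 0 ]≔ u) v) (indep 0<2 a u))
    where
    first : (a [ p 0 ]≔ u [ p 1 ]≔ v) ! p 0 ≡ u
    first = trans (!-≔-≢ (a [ p 0 ]≔ u) v (distinct 1<2 0<2 λ ())) (!-≔ a u (bounded 0<2))
    second : (a [ p 0 ]≔ u [ p 1 ]≔ v) ! p 1 ≡ v
    second = !-≔ (a [ p 0 ]≔ u) v (bounded 1<2)
cycle-sum {n} (suc (suc (suc r))) p emb G indep a = begin
  sumOver (applyUpTo p (3 + r)) H a
    ≡⟨ sumOver-↭ vars-↭ H a ⟩
  sumOver (applyUpTo q (1 + r) ++ ends) H a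
    ≡⟨ sumOver-++ (applyUpTo q (1 + r)) ends H a ⟩
  sumOver (applyUpTo q (1 + r)) (sumOver ends H) a
    ≡⟨ sumOver-cong (applyUpTo q (1 + r))
                    (sumOver-ends r p emb G (indep (s≤s z≤n)) (indep ℕ.≤-refl)) a ⟩
  sumOver (applyUpTo q (1 + r)) (λ b → sign (cycleForm q (1 + r) b) *ℤ (+ 2 *ℤ G b)) a
    ≡⟨ cycle-sum (suc r) q (embedding-≤ (ℕ.n≤1+n _) (embedding-suc emb)) (λ b → + 2 *ℤ G b)
                 (λ j<1+r b v → cong (+ 2 *ℤ_) (indep (s≤s (ℕ.m≤n⇒m≤1+n j<1+r)) b v)) a ⟩
  cycleSum (1 + r) *ℤ (+ 2 *ℤ G a)
    ≡⟨ *-x∙yz≈yx∙z (cycleSum (1 + r)) (+ 2) (G a) ⟩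
  (+ 2 *ℤ cycleSum (1 + r)) *ℤ G a ∎
  where
  open ≡-Reasoning
  H : Fun n
  H e = sign (cycleForm p (3 + r) e) *ℤ G e
  q : ℕ → ℕ
  q = p ∘ suc
  ends : List ℕ
  ends = p 0 ∷ p (2 + r) ∷ []
  vars-↭ : applyUpTo p (3 + r) ↭ applyUpTo q (1 + r) ++ ends
  vars-↭ = ↭-trans (↭-reflexive (cong (p 0 ∷_) (sym (List.applyUpTo-∷ʳ q (1 + r)))))
                   (↭-sym (Perm.shift (p 0) (applyUpTo q (1 + r)) (p (2 + r) ∷ [])))

record CycleFamily (n D m : ℕ) (P : ℕ → ℕ → ℕ) : Set where
  field
    bounded   : ∀ {c j} → c < D → j < m → P c j < n
    injective : ∀ {c c′ j j′} → c < D → c′ < D → j < m → j′ < m →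
                P c j ≡ P c′ j′ → c ≡ c′ × j ≡ j′

  cycle : ∀ {c} → c < D → Embedding m n (P c)
  cycle c<D = record
    { bounded   = bounded c<D
    ; injective = λ j<m j′<m → proj₂ ∘ injective c<D c<D j<m j′<m
    }

family-pred : ∀ {n D m P} → CycleFamily n (suc D) m P → CycleFamily n D m P
family-pred fam = record
  { bounded   = bounded ∘ ℕ.m≤n⇒m≤1+n
  ; injective = λ c<D c′<D → injective (ℕ.m≤n⇒m≤1+n c<D) (ℕ.m≤n⇒m≤1+n c′<D)
  }
  where open CycleFamily fam

cyclesVars : (ℕ → ℕ → ℕ) → ℕ → ℕ → List ℕ
cyclesVars P m zero    = []
cyclesVars P m (suc D) = applyUpTo (P D) m ++ cyclesVars P m D

cyclesForm : ∀ {n} → (ℕ → ℕ → ℕ) → ℕ → ℕ → Vec Bool n → Bool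
cyclesForm P m zero    a = false
cyclesForm P m (suc D) a = cycleForm (P D) m a xor cyclesForm P m D a

cycles-sum : ∀ {n D m P} → CycleFamily n D m P → (G : Fun n) →
             (∀ {c j} → c < D → j < m → Independent (P c j) G) →
             ∀ a → sumOver (cyclesVars P m D) (λ e → sign (cyclesForm P m D e) *ℤ G e) a
                     ≡ cycleSum m ^ℤ D *ℤ G a
cycles-sum {D = zero} fam G indep a = refl
cycles-sum {n} {suc D} {m} {P} fam G indep a = begin
  sumOver (applyUpTo (P D) m ++ cyclesVars P m D) H a
    ≡⟨ sumOver-++ (applyUpTo (P D) m) _ H a ⟩
  sumOver (applyUpTo (P D) m) (sumOver (cyclesVars P m D) H) a
    ≡⟨ sumOver-cong (applyUpTo (P D) m) other-cycles a ⟩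
  sumOver (applyUpTo (P D) m) (λ b → sign (C b) *ℤ (cycleSum m ^ℤ D *ℤ G b)) a
    ≡⟨ cycle-sum m (P D) (cycle ℕ.≤-refl) (λ b → cycleSum m ^ℤ D *ℤ G b)
                 (λ j<m b v → cong (cycleSum m ^ℤ D *ℤ_) (indep ℕ.≤-refl j<m b v)) a ⟩
  cycleSum m *ℤ (cycleSum m ^ℤ D *ℤ G a)
    ≡⟨ sym (ℤ.*-assoc (cycleSum m) (cycleSum m ^ℤ D) (G a)) ⟩
  cycleSum m ^ℤ suc D *ℤ G a ∎
  where
  open ≡-Reasoning
  open CycleFamily fam
  C : Vec Bool n → Bool
  C = cycleForm (P D) m
  H : Fun n
  H e = sign (C e xor cyclesForm P m D e) *ℤ G e
  C·G-indep : ∀ {c j} → c < D → j < m → Independent (P c j) (λ e → sign (C e) *ℤ G e)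
  C·G-indep {c} {j} c<D j<m b v = cong₂ _*ℤ_
    (cong sign (cycleForm-cong (P D) m (b [ P c j ]≔ v) b λ j′ j′<m →
      !-≔-≢ b v λ eq →
        ℕ.<⇒≢ c<D (proj₁ (injective (ℕ.m≤n⇒m≤1+n c<D) ℕ.≤-refl j<m j′<m eq))))
    (indep (ℕ.m≤n⇒m≤1+n c<D) j<m b v)
  other-cycles : ∀ b → sumOver (cyclesVars P m D) H b ≡ sign (C b) *ℤ (cycleSum m ^ℤ D *ℤ G b)
  other-cycles b = begin
    sumOver (cyclesVars P m D) H b
      ≡⟨ sumOver-cong (cyclesVars P m D) (λ e → trans (cong (_*ℤ G e) (sign-xor (C e) _))
                                                      (*-xy∙z≈y∙xz (sign (C e)) _ (G e))) b ⟩
    sumOver (cyclesVars P m D) (λ e → sign (cyclesForm P m D e) *ℤ (sign (C e) *ℤ G e)) b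
      ≡⟨ cycles-sum (family-pred fam) (λ e → sign (C e) *ℤ G e) C·G-indep b ⟩
    cycleSum m ^ℤ D *ℤ (sign (C b) *ℤ G b)
      ≡⟨ *-x∙yz≈y∙xz (cycleSum m ^ℤ D) (sign (C b)) (G b) ⟩
    sign (C b) *ℤ (cycleSum m ^ℤ D *ℤ G b) ∎

∈-cyclesVars⁻ : ∀ {P m D z} → z ∈ cyclesVars P m D →
                ∃ λ c → ∃ λ j → c < D × j < m × z ≡ P c j
∈-cyclesVars⁻ {P} {m} {suc D} z∈ with ∈-++⁻ (applyUpTo (P D) m) z∈
... | inj₁ z∈cycle with ∈-applyUpTo⁻ (P D) z∈cycle
...   | j , j<m , z≡ = D , j , ℕ.≤-refl , j<m , z≡
∈-cyclesVars⁻ {P} {m} {suc D} z∈ | inj₂ z∈others with ∈-cyclesVars⁻ {D = D} z∈others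
...   | c , j , c<D , j<m , z≡ = c , j , ℕ.m≤n⇒m≤1+n c<D , j<m , z≡

length-cyclesVars : ∀ P m D → length (cyclesVars P m D) ≡ D * m
length-cyclesVars P m zero    = refl
length-cyclesVars P m (suc D) =
  trans (List.length-++ (applyUpTo (P D) m))
        (cong₂ _+_ (List.length-applyUpTo (P D) m) (length-cyclesVars P m D))

cyclesVars-unique : ∀ {n D m P} → CycleFamily n D m P → Unique (cyclesVars P m D)
cyclesVars-unique {D = zero}  fam = []
cyclesVars-unique {D = suc D} {m} {P} fam =
  Unique.++⁺ (Unique.applyUpTo⁺₁ (P D) m λ i<j j<m →
               distinct (ℕ.<-trans i<j j<m) j<m (ℕ.<⇒≢ i<j))
             (cyclesVars-unique (family-pred fam))
             disjoint
  where
  open CycleFamily fam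
  open Embedding (cycle ℕ.≤-refl) using (distinct)
  disjoint : ∀ {z} → ¬ (z ∈ applyUpTo (P D) m × z ∈ cyclesVars P m D)
  disjoint (z∈cycle , z∈others)
    with ∈-applyUpTo⁻ (P D) z∈cycle | ∈-cyclesVars⁻ {D = D} z∈others
  ... | j , j<m , refl | c , j′ , c<D , j′<m , eq =
    ℕ.<⇒≢ c<D (sym (proj₁ (injective ℕ.≤-refl (ℕ.m≤n⇒m≤1+n c<D) j<m j′<m eq)))

xorSum-cyclesVars : ∀ {n} P m D (f : ℕ → Bool) (a : Vec Bool n) →
                    (∀ {c} → c < D → xorSum (applyUpTo (f ∘ P c) m) ≡ cycleForm (P c) m a) →
                    xorSum (map f (cyclesVars P m D)) ≡ cyclesForm P m D a
xorSum-cyclesVars P m zero    f a f≡ = refl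
xorSum-cyclesVars P m (suc D) f a f≡ = begin
  xorSum (map f (applyUpTo (P D) m ++ cyclesVars P m D))
    ≡⟨ cong xorSum (List.map-++ f (applyUpTo (P D) m) _) ⟩
  xorSum (map f (applyUpTo (P D) m) ++ map f (cyclesVars P m D))
    ≡⟨ xorSum-++ (map f (applyUpTo (P D) m)) _ ⟩
  xorSum (map f (applyUpTo (P D) m)) xor xorSum (map f (cyclesVars P m D))
    ≡⟨ cong₂ _xor_ (trans (cong xorSum (List.map-applyUpTo (P D) f m)) (f≡ ℕ.≤-refl))
                   (xorSum-cyclesVars P m D f a (f≡ ∘ ℕ.m≤n⇒m≤1+n)) ⟩
  cyclesForm P m (suc D) a ∎
  where open ≡-Reasoning

cycleSum-even : ∀ t → cycleSum (suc t * 2) ≡ (+ 2) ^ℤ (2 + t)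
cycleSum-even zero    = refl
cycleSum-even (suc t) = cong (+ 2 *ℤ_) (cycleSum-even t)

cycleSum-odd : ∀ t → cycleSum (suc (t * 2)) ≡ + 0
cycleSum-odd zero    = refl
cycleSum-odd (suc t) = cong (+ 2 *ℤ_) (cycleSum-odd t)

+-^ : ∀ a e → + (a ^ e) ≡ (+ a) ^ℤ e
+-^ a zero    = refl
+-^ a (suc e) = trans (ℤ.pos-* a (a ^ e)) (cong (+ a *ℤ_) (+-^ a e))

0^ℤ-nonZero : ∀ e .{{_ : NonZero e}} → (+ 0) ^ℤ e ≡ + 0
0^ℤ-nonZero (suc e) = ℤ.*-zeroˡ ((+ 0) ^ℤ e)

¬2∣⇒odd : ∀ m → ¬ 2 ∣ m → m ≡ suc (m / 2 * 2)
¬2∣⇒odd m ¬2∣m with m % 2 in m%2≡ | m%n<n m 2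
... | zero        | _ = ⊥-elim (¬2∣m (m%n≡0⇒n∣m m 2 m%2≡))
... | suc zero    | _ = trans (m≡m%n+[m/n]*n m 2) (cong (λ r → r + m / 2 * 2) m%2≡)
... | suc (suc _) | s≤s (s≤s ())

cycleSum^-even : ∀ {n m d} .{{_ : NonZero m}} → d * m ≡ n → 2 ∣ m →
                 cycleSum m ^ℤ d ≡ + (2 ^ (n / 2 + d))
cycleSum^-even {m = m} _ (divides zero m≡0) = ⊥-elim (≢-nonZero⁻¹ m m≡0)
cycleSum^-even {n} {m} {d} d*m≡n (divides (suc t) m≡[1+t]*2) = begin
  cycleSum m ^ℤ d          ≡⟨ cong (_^ℤ d) (trans (cong cycleSum m≡[1+t]*2) (cycleSum-even t)) ⟩
  ((+ 2) ^ℤ (2 + t)) ^ℤ d  ≡⟨ ℤ.^-*-assoc (+ 2) (2 + t) d ⟩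
  (+ 2) ^ℤ ((2 + t) * d)   ≡⟨ sym (+-^ 2 ((2 + t) * d)) ⟩
  + (2 ^ ((2 + t) * d))    ≡⟨ cong (λ e → + (2 ^ e)) exponent ⟩
  + (2 ^ (n / 2 + d))      ∎
  where
  open ≡-Reasoning
  n/2≡d*[1+t] : n / 2 ≡ d * suc t
  n/2≡d*[1+t] = begin
    n / 2                 ≡⟨ cong (_/ 2) (sym d*m≡n) ⟩
    d * m / 2             ≡⟨ cong (λ m′ → d * m′ / 2) m≡[1+t]*2 ⟩
    d * (suc t * 2) / 2   ≡⟨ cong (_/ 2) (sym (ℕ.*-assoc d (suc t) 2)) ⟩
    d * suc t * 2 / 2     ≡⟨ m*n/n≡m (d * suc t) 2 ⟩
    d * suc t             ∎
  rearrange : ∀ t d → (2 + t) * d ≡ d * suc t + d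
  rearrange = ℕ-solve-∀
  exponent : (2 + t) * d ≡ n / 2 + d
  exponent = trans (rearrange t d) (cong (_+ d) (sym n/2≡d*[1+t]))

cycleSum^-odd : ∀ {m} d .{{_ : NonZero d}} → ¬ 2 ∣ m → cycleSum m ^ℤ d ≡ + 0
cycleSum^-odd {m} d ¬2∣m =
  trans (cong (_^ℤ d) (trans (cong cycleSum (¬2∣⇒odd m ¬2∣m)) (cycleSum-odd (m / 2)))) (0^ℤ-nonZero d)

-- Orbits of a rotation

module _ {n k m d : ℕ} .{{_ : NonZero n}} .{{_ : NonZero m}} .{{_ : NonZero d}}
         (d*m≡n : d * m ≡ n) (n∣m*k : n ∣ m * k)
         (minimal : ∀ j → 0 < j → j < m → ¬ n ∣ j * k) where

  orbit : ℕ → ℕ → ℕ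
  orbit c j = (c + j * k) % n

  private
    d∣n : d ∣ n
    d∣n = divides m (trans (sym d*m≡n) (ℕ.*-comm d m))

    d∣k : d ∣ k
    d∣k = *-cancelʳ-∣ m (subst (_∣ k * m) (sym d*m≡n) (subst (n ∣_) (ℕ.*-comm m k) n∣m*k))

    orbit-%-d : ∀ {c} j → c < d → orbit c j % d ≡ c
    orbit-%-d {c} j c<d =
      trans (m∣n⇒o%n%m≡o%m d n (c + j * k) d∣n)
            (trans (%-remove-+ʳ c (∣n⇒∣m*n j d∣k)) (m<n⇒m%n≡m c<d))

    orbit-step : ∀ c j → (orbit c j + k) % n ≡ orbit c (suc j)
    orbit-step c j = trans ([m%o+n]%o≡[m+n]%o (c + j * k) k n)
                           (cong (_% n) (trans (ℕ.+-assoc c (j * k) k) (cong (_+_ c) (ℕ.+-comm (j * k) k))))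

    orbit-wrap : ∀ c → orbit c m ≡ orbit c 0
    orbit-wrap c = trans (%-remove-+ʳ c n∣m*k) (cong (_% n) (sym (ℕ.+-identityʳ c)))

    orbit-< : ∀ {c j j′} → j < j′ → j′ < m → orbit c j ≢ orbit c j′
    orbit-< {c} {j} {j′} j<j′ j′<m eq with ℕ.m≤n⇒∃[o]m+o≡n j<j′
    ... | o , refl = minimal (suc o) (s≤s z≤n) (ℕ.≤-<-trans (s≤s (ℕ.m≤n+m o j)) j′<m)
                             (%-≡-+⇒∣ (c + j * k) (suc o * k) (trans eq (cong (_% n) (split c j o k))))
      where
      split : ∀ c j o k → c + (suc j + o) * k ≡ (c + j * k) + suc o * k
      split = ℕ-solve-∀

  -- Orbits are told apart by the residue mod d, which divides both n and k; inside one orbit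
  -- the points orbit c j for j < m are distinct by minimality of m.
  orbits : CycleFamily n d m orbit
  orbits = record
    { bounded   = λ {c} {j} _ _ → m%n<n (c + j * k) n
    ; injective = injective
    }
    where
    injective : ∀ {c c′ j j′} → c < d → c′ < d → j < m → j′ < m →
                orbit c j ≡ orbit c′ j′ → c ≡ c′ × j ≡ j′
    injective {c} {c′} {j} {j′} c<d c′<d j<m j′<m eq
      with trans (sym (orbit-%-d j c<d)) (trans (cong (_% d) eq) (orbit-%-d j′ c′<d))
    ... | refl with ℕ.<-cmp j j′
    ...   | tri< j<j′ _ _ = ⊥-elim (orbit-< j<j′ j′<m eq)
    ...   | tri≈ _ j≡j′ _ = refl , j≡j′
    ...   | tri> _ _ j′<j = ⊥-elim (orbit-< j′<j j<m (sym eq))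

  upTo-↭-orbits : upTo n ↭ cyclesVars orbit m d
  upTo-↭-orbits = ↭-sym (unique-⊆⇒↭ (cyclesVars-unique orbits) ⊆upTo
                                     (trans (length-cyclesVars orbit m d) (trans d*m≡n (sym (List.length-upTo n)))))
    where
    ⊆upTo : ∀ {z} → z ∈ cyclesVars orbit m d → z ∈ upTo n
    ⊆upTo z∈ with ∈-cyclesVars⁻ {orbit} {m} {d} z∈
    ... | c , j , c<d , j<m , refl = ∈-upTo⁺ (CycleFamily.bounded orbits c<d j<m)

  dot-rotation : ∀ (a : Vec Bool n) → dot a (iter k ρ a) ≡ cyclesForm orbit m d a
  dot-rotation a = begin
    dot a (iter k ρ a)
      ≡⟨ dot≡xorSum a (iter k ρ a) ⟩
    xorSum (applyUpTo (λ i → a ! i ∧ iter k ρ a ! i) n)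
      ≡⟨ xorSum-applyUpTo-cong n (λ i i<n → cong (a ! i ∧_) (!-iter-ρ k a i<n)) ⟩
    xorSum (applyUpTo f n)
      ≡⟨ cong xorSum (sym (List.map-applyUpTo (λ i → i) f n)) ⟩
    xorSum (map f (upTo n))
      ≡⟨ xorSum-↭ (Perm.map⁺ f upTo-↭-orbits) ⟩
    xorSum (map f (cyclesVars orbit m d))
      ≡⟨ xorSum-cyclesVars orbit m d f a along-orbit ⟩
    cyclesForm orbit m d a ∎
    where
    open ≡-Reasoning
    f : ℕ → Bool
    f i = a ! i ∧ a ! ((i + k) % n)
    along-orbit : ∀ {c} → c < d → xorSum (applyUpTo (f ∘ orbit c) m) ≡ cycleForm (orbit c) m a
    along-orbit {c} _ =
      xorSum-closed-walk a (λ i → (i + k) % n) (orbit c) m (λ j _ → orbit-step c j) (orbit-wrap c)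

  S-rotation : S {n} (iter k ρ) ≡ cycleSum m ^ℤ d
  S-rotation = begin
    sumℤ (map F (allVecs n))
      ≡⟨ sumℤ-allVecs n F a₀ ⟩
    sumOver (upTo n) F a₀
      ≡⟨ sumOver-↭ upTo-↭-orbits F a₀ ⟩
    sumOver (cyclesVars orbit m d) F a₀
      ≡⟨ sumOver-cong (cyclesVars orbit m d)
                      (λ e → trans (cong sign (dot-rotation e)) (sym (ℤ.*-identityʳ _))) a₀ ⟩
    sumOver (cyclesVars orbit m d) (λ e → sign (cyclesForm orbit m d e) *ℤ + 1) a₀
      ≡⟨ cycles-sum orbits (λ _ → + 1) (λ _ _ _ _ → refl) a₀ ⟩
    cycleSum m ^ℤ d *ℤ + 1
      ≡⟨ ℤ.*-identityʳ _ ⟩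
    cycleSum m ^ℤ d ∎
    where
    open ≡-Reasoning
    F : Fun n
    F a = sign (dot a (iter k ρ a))
    a₀ : Vec Bool n
    a₀ = replicate n false

proposition2 : (n : ℕ) → 2 < n → (k : ℕ) → (m : ℕ) → .{{_ : NonZero m}}
    → IsOrder {n} (iter k ρ) m
    → ((2 ∣ m) → S {n} (iter k ρ) ≡ + (2 ^ (n / 2 + n / m)))
    × (¬ (2 ∣ m) → S {n} (iter k ρ) ≡ + 0)
proposition2 n@(suc _) _ k m σ-order with order-of-rotation {n} {k} {m} σ-order
... | n∣m*k , minimal , m∣n =
  (λ 2∣m → trans S≡ (cycleSum^-even d*m≡n 2∣m)) , (λ ¬2∣m → trans S≡ (cycleSum^-odd d ¬2∣m))
  where
  d : ℕ
  d = n / m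
  instance
    d≢0 : NonZero d
    d≢0 = >-nonZero (m≥n⇒m/n>0 (∣⇒≤ m∣n))
  d*m≡n : d * m ≡ n
  d*m≡n = m/n*n≡m m∣n
  S≡ : S {n} (iter k ρ) ≡ cycleSum m ^ℤ d
  S≡ = S-rotation {n} {k} {m} {d} d*m≡n n∣m*k minimal
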